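{- Let $L=\left(\frac{1+yx+yx^2}{(1+x)^2},\frac{x}{(1+x)^2}\right)$ and let $\mu_n(y)$ be the $(n,0)$ entry of $L^{ -1}$. Then the generating function $\sum_{n\ge0}\mu_n(y)x^n$ equals the continued fraction $$\cfrac{1}{1-(2-y)x-\cfrac{(1-y)x^2}{1-2x-\cfrac{x^2}{1-2x-\cfrac{x^2}{1-2x-\cdots}}}}.$$ -}

module Defs where

open import Data.Nat using (ℕ; zero; suc; _∸_; _<_)
open import Relation.Binary.PropositionalEquality using (_≡_)
open import Data.Integer using (ℤ; 0ℤ; 1ℤ; +_; _+_; _*_; -_)

-- Polynomials in y with integer coefficients, represented by their
-- coefficient sequences:  p m = coefficient of y^m.
-- Equality of polynomials is pointwise equality of coefficients.

P : Set
P = ℕ → ℤ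

sumTo : ℕ → (ℕ → ℤ) → ℤ
sumTo zero    f = f 0
sumTo (suc n) f = sumTo n f + f (suc n)

0P : P
0P _ = 0ℤ

cP : ℤ → P
cP c zero    = c
cP c (suc _) = 0ℤ

1P : P
1P = cP 1ℤ

yP : P
yP 1 = 1ℤ
yP _ = 0ℤ

_+P_ : P → P → P
(a +P b) m = a m + b m

-P_ : P → P
(-P a) m = - a m

_*P_ : P → P → P
(a *P b) m = sumTo m (λ j → a j * b (m ∸ j))

sumToP : ℕ → (ℕ → P) → P
sumToP n f m = sumTo n (λ i → f i m)

-- Formal power series in x with coefficients in ℤ[y]:
-- s n = coefficient of x^n (a polynomial in y).

Ser : Set
Ser = ℕ → P

0S : Ser
0S _ = 0P

K : P → Ser
K p zero    = p
K p (suc _) = 0P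

1S : Ser
1S = K 1P

xS : Ser
xS 1 = 1P
xS _ = 0P

_+S_ : Ser → Ser → Ser
(a +S b) n = a n +P b n

-S_ : Ser → Ser
(-S a) n = -P a n

_-S_ : Ser → Ser → Ser
a -S b = a +S (-S b)

_*S_ : Ser → Ser → Ser
(a *S b) n = sumToP n (λ i → a i *P b (n ∸ i))

infixl 6 _+S_ _-S_
infixl 7 _*S_

powS : Ser → ℕ → Ser
powS a zero    = 1S
powS a (suc k) = a *S powS a k

-- Multiplicative inverse of a series a whose x^0-coefficient is the
-- polynomial 1:  1/a = 1/(1-u) = Σ_k u^k with u = 1 - a (u has no
-- constant term, so the x^n coefficient only involves k ≤ n).
invS : Ser → Ser
invS a n = sumToP n (λ k → powS (1S -S a) k n)

-- The Riordan array L = (g(x), f(x)) with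
--   g = (1 + y x + y x^2)/(1+x)^2 ,   f = x/(1+x)^2 ;
-- its (n,k) entry is [x^n] g f^k.

onePlusXSq : Ser
onePlusXSq = powS (1S +S xS) 2

gL : Ser
gL = (1S +S K yP *S xS +S K yP *S powS xS 2) *S invS onePlusXSq

fL : Ser
fL = xS *S invS onePlusXSq

Lmat : ℕ → ℕ → P
Lmat n k = (gL *S powS fL k) n

Mat : Set
Mat = ℕ → ℕ → P

LowerTriangular : Mat → Set
LowerTriangular A = ∀ i j → i < j → ∀ m → A i j m ≡ 0ℤ

-- product of lower-triangular matrices: (AB)(i,j) = Σ_{k=0}^{i} A(i,k) B(k,j)
-- (terms with k > i vanish since A is lower triangular)
_·M_ : Mat → Mat → Mat
(A ·M B) i j = sumToP i (λ k → A i k *P B k j)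

IdM : Mat
IdM zero    zero    = 1P
IdM zero    (suc _) = 0P
IdM (suc _) zero    = 0P
IdM (suc i) (suc j) = IdM i j

-- Convergents of the continued fraction
--   1 / (1 - (2-y)x - (1-y)x^2 / (1 - 2x - x^2 / (1 - 2x - ...)))
-- tailCF k is the depth-k truncation of the periodic tail
--   1/(1 - 2x - x^2/(1 - 2x - ...)), truncated by 0.

tailCF : ℕ → Ser
tailCF zero    = 0S
tailCF (suc k) = invS (1S -S K (cP (+ 2)) *S xS -S powS xS 2 *S tailCF k)

convCF : ℕ → Ser
convCF k = invS (1S -S K (cP (+ 2) +P (-P yP)) *S xS
                    -S K (1P +P (-P yP)) *S powS xS 2 *S tailCF k)

-- Write σ = (1+x)², f = x/σ, g = (1+yx+yx²)/σ, D t = 1 - 2x - x² t and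
-- E t = 1 - (2-y)x - (1-y)x² t.  The truncated tails t_{k+1} = 1/D(t_k)
-- converge x-adically to T with T·D(T) = 1, and the convergents 1/E(t_k) to
-- W = 1/E(T), the x^n coefficient being exact once k > n.  Substituting
-- x ↦ f, both T(f) and σ solve  u·(1 - 2f - f²u) = 1  (as f·σ = x), whose
-- solution is unique; hence T(f) = σ and W(f)·g = W(f)·(1 - (2-y)f - (1-y)f²σ) = 1.
-- By the fundamental theorem of Riordan arrays g·μ(f) = 1 as well, so
-- μ(f) = W(f), and μ = W since substituting f is injective.

module Submission where

open import Defs
open import Data.Nat using (ℕ; _≤_)
open import Data.Integer using (ℤ)
open import Data.Product using (∃-syntax)
open import Relation.Binary.PropositionalEquality using (_≡_)

open import Algebra.Bundles using (CommutativeRing)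
open import Data.Nat using (zero; suc; _∸_; _<_; z≤n; s≤s)
import Data.Nat as ℕ
import Data.Nat.Properties as ℕ
open import Data.Nat.Properties using (≤-refl; ≤-trans; n≤1+n; m∸n≤m; n∸n≡0; m∸n+n≡m)
open import Data.Product using (_,_)
import Relation.Binary.PropositionalEquality as ≡
import Data.Integer as ℤ
import Data.Integer.Properties as ℤ

module IntegerCoefficientSolver {c ℓ} (R : CommutativeRing c ℓ) where
  open CommutativeRing R
  open import Relation.Binary.Reasoning.Setoid setoid
  open import Algebra.Properties.Semiring.Mult.TCOptimised semiring
    using (_×_; 1+×; ×-homo-+; ×1-homo-*)
  open import Algebra.Properties.Ring ring using (-0#≈0#; -‿distribˡ-*; -‿distribʳ-*)
  open import Algebra.Properties.AbelianGroup +-abelianGroup using (⁻¹-∙-comm)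
  open import Algebra.Properties.Group +-group using (⁻¹-involutive)
  open import Algebra.Properties.CommutativeSemigroup +-commutativeSemigroup using (interchange)
  open import Algebra.Solver.Ring.AlmostCommutativeRing
    using (fromCommutativeRing; _-Raw-AlmostCommutative⟶_)
  import Algebra.Solver.Ring as Solver
  import Data.Sign as Sign
  open import Data.Maybe using (map)
  open import Relation.Binary.Consequences using (dec⇒weaklyDec)

  ι : ℤ → Carrier
  ι (ℤ.+ n)    = n × 1#
  ι ℤ.-[1+ n ] = - (suc n × 1#)

  ι-⊖ : ∀ m n → ι (m ℤ.⊖ n) ≈ m × 1# - n × 1#
  ι-⊖ zero    zero    = sym (-‿inverseʳ 0#)
  ι-⊖ (suc m) zero    = sym (trans (+-congˡ -0#≈0#) (+-identityʳ _))
  ι-⊖ zero    (suc n) = sym (+-identityˡ _)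
  ι-⊖ (suc m) (suc n) = begin
    ι (suc m ℤ.⊖ suc n)             ≡⟨ ≡.cong ι (ℤ.[1+m]⊖[1+n]≡m⊖n m n) ⟩
    ι (m ℤ.⊖ n)                     ≈⟨ ι-⊖ m n ⟩
    m × 1# - n × 1#                 ≈⟨ sym (+-identityˡ _) ⟩
    0# + (m × 1# - n × 1#)          ≈⟨ +-congʳ (sym (-‿inverseʳ 1#)) ⟩
    (1# - 1#) + (m × 1# - n × 1#)   ≈⟨ interchange _ _ _ _ ⟩
    (1# + m × 1#) + (- 1# - n × 1#) ≈⟨ +-congˡ (⁻¹-∙-comm _ _) ⟩
    (1# + m × 1#) - (1# + n × 1#)   ≈⟨ sym (+-cong (1+× m 1#) (-‿cong (1+× n 1#))) ⟩
    suc m × 1# - suc n × 1#         ∎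

  ι-+ : ∀ i j → ι (i ℤ.+ j) ≈ ι i + ι j
  ι-+ (ℤ.+ m)    (ℤ.+ n)    = ×-homo-+ 1# m n
  ι-+ (ℤ.+ m)    ℤ.-[1+ n ] = ι-⊖ m (suc n)
  ι-+ ℤ.-[1+ m ] (ℤ.+ n)    = trans (ι-⊖ n (suc m)) (+-comm _ _)
  ι-+ ℤ.-[1+ m ] ℤ.-[1+ n ] = begin
    - (suc (suc (m ℕ.+ n)) × 1#)    ≡⟨ ≡.cong (λ k → - (suc k × 1#)) (≡.sym (ℕ.+-suc m n)) ⟩
    - ((suc m ℕ.+ suc n) × 1#)      ≈⟨ -‿cong (×-homo-+ 1# (suc m) (suc n)) ⟩
    - (suc m × 1# + suc n × 1#)     ≈⟨ sym (⁻¹-∙-comm _ _) ⟩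
    - (suc m × 1#) + - (suc n × 1#) ∎

  signed : Sign.Sign → Carrier → Carrier
  signed Sign.+ x = x
  signed Sign.- x = - x

  signed-cong : ∀ s {x y} → x ≈ y → signed s x ≈ signed s y
  signed-cong Sign.+ e = e
  signed-cong Sign.- e = -‿cong e

  ι-◃ : ∀ s n → ι (s ℤ.◃ n) ≈ signed s (n × 1#)
  ι-◃ Sign.- zero    = sym -0#≈0#
  ι-◃ Sign.- (suc n) = refl
  ι-◃ Sign.+ zero    = refl
  ι-◃ Sign.+ (suc n) = refl

  ι-signed : ∀ i → ι i ≈ signed (ℤ.sign i) (ℤ.∣ i ∣ × 1#)
  ι-signed (ℤ.+ zero)  = refl
  ι-signed (ℤ.+ suc n) = refl
  ι-signed ℤ.-[1+ n ]  = refl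

  signed-* : ∀ s t x y → signed (s Sign.* t) (x * y) ≈ signed s x * signed t y
  signed-* Sign.- Sign.- x y = trans (sym (⁻¹-involutive _)) (trans (-‿cong (-‿distribˡ-* x y)) (-‿distribʳ-* _ _))
  signed-* Sign.- Sign.+ x y = -‿distribˡ-* x y
  signed-* Sign.+ Sign.- x y = -‿distribʳ-* x y
  signed-* Sign.+ Sign.+ x y = refl

  ι-* : ∀ i j → ι (i ℤ.* j) ≈ ι i * ι j
  ι-* i j = begin
    ι (i ℤ.* j)                               ≈⟨ ι-◃ (s Sign.* t) (∣i∣ ℕ.* ∣j∣) ⟩
    signed (s Sign.* t) ((∣i∣ ℕ.* ∣j∣) × 1#)  ≈⟨ signed-cong (s Sign.* t) (×1-homo-* ∣i∣ ∣j∣) ⟩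
    signed (s Sign.* t) (∣i∣ × 1# * ∣j∣ × 1#) ≈⟨ signed-* s t _ _ ⟩
    signed s (∣i∣ × 1#) * signed t (∣j∣ × 1#) ≈⟨ sym (*-cong (ι-signed i) (ι-signed j)) ⟩
    ι i * ι j                                 ∎
    where
    s = ℤ.sign i
    t = ℤ.sign j
    ∣i∣ = ℤ.∣ i ∣
    ∣j∣ = ℤ.∣ j ∣

  ι-neg : ∀ i → ι (ℤ.- i) ≈ - ι i
  ι-neg (ℤ.+ zero)  = sym -0#≈0#
  ι-neg (ℤ.+ suc n) = refl
  ι-neg ℤ.-[1+ n ]  = sym (⁻¹-involutive _)

  ι-homomorphism : CommutativeRing.rawRing ℤ.+-*-commutativeRing -Raw-AlmostCommutative⟶ fromCommutativeRing R
  ι-homomorphism = record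
    { ⟦_⟧ = ι ; +-homo = ι-+ ; *-homo = ι-* ; -‿homo = ι-neg ; 0-homo = refl ; 1-homo = refl }

  open Solver (CommutativeRing.rawRing ℤ.+-*-commutativeRing) (fromCommutativeRing R) ι-homomorphism
    (λ m n → map (λ m≡n → reflexive (≡.cong ι m≡n)) (dec⇒weaklyDec ℤ._≟_ m n)) public

  :1 :2 : ∀ {n} → Polynomial n
  :1 = con (ℤ.+ 1)
  :2 = con (ℤ.+ 2)

module PowerSeriesRing {c ℓ} (R : CommutativeRing c ℓ) where
  open CommutativeRing R
  open import Relation.Binary.Reasoning.Setoid setoid
  open IntegerCoefficientSolver R using (solve; _:=_; _:+_; _:*_)

  Series : Set c
  Series = ℕ → Carrier

  infix 4 _≐_
  _≐_ : Series → Series → Set ℓ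
  a ≐ b = ∀ n → a n ≈ b n

  Σ : ℕ → (ℕ → Carrier) → Carrier
  Σ zero    f = f 0
  Σ (suc n) f = Σ n f + f (suc n)

  Σ-cong : ∀ n {f g : ℕ → Carrier} → (∀ i → i ≤ n → f i ≈ g i) → Σ n f ≈ Σ n g
  Σ-cong zero    f≈g = f≈g 0 z≤n
  Σ-cong (suc n) f≈g = +-cong (Σ-cong n (λ i i≤n → f≈g i (≤-trans i≤n (n≤1+n n)))) (f≈g (suc n) ≤-refl)

  Σ-zero : ∀ n {f : ℕ → Carrier} → (∀ i → i ≤ n → f i ≈ 0#) → Σ n f ≈ 0#
  Σ-zero n f≈0 = trans (Σ-cong n f≈0) (sum0 n)
    where
    sum0 : ∀ n → Σ n (λ _ → 0#) ≈ 0#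
    sum0 zero    = refl
    sum0 (suc n) = trans (+-identityʳ _) (sum0 n)

  Σ-+ : ∀ n (f g : ℕ → Carrier) → Σ n (λ i → f i + g i) ≈ Σ n f + Σ n g
  Σ-+ zero    f g = refl
  Σ-+ (suc n) f g = begin
    Σ n (λ i → f i + g i) + (f (suc n) + g (suc n)) ≈⟨ +-congʳ (Σ-+ n f g) ⟩
    (Σ n f + Σ n g) + (f (suc n) + g (suc n))       ≈⟨ interchange _ _ _ _ ⟩
    (Σ n f + f (suc n)) + (Σ n g + g (suc n))       ∎
    where open import Algebra.Properties.CommutativeSemigroup +-commutativeSemigroup using (interchange)

  Σ-*ˡ : ∀ n r (f : ℕ → Carrier) → r * Σ n f ≈ Σ n (λ i → r * f i)
  Σ-*ˡ zero    r f = refl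
  Σ-*ˡ (suc n) r f = trans (distribˡ r (Σ n f) (f (suc n))) (+-congʳ (Σ-*ˡ n r f))

  Σ-shift : ∀ n (f : ℕ → Carrier) → Σ (suc n) f ≈ f 0 + Σ n (λ i → f (suc i))
  Σ-shift zero    f = refl
  Σ-shift (suc n) f = trans (+-congʳ (Σ-shift n f)) (+-assoc _ _ _)

  Σ-extend : ∀ {n N} (f : ℕ → Carrier) → n ≤ N → (∀ i → n < i → f i ≈ 0#) → Σ N f ≈ Σ n f
  Σ-extend {n} {N} f n≤N vanish = begin
    Σ N f               ≡⟨ ≡.cong (λ m → Σ m f) (≡.sym (m∸n+n≡m n≤N)) ⟩
    Σ (N ∸ n ℕ.+ n) f   ≈⟨ pad (N ∸ n) ⟩
    Σ n f               ∎
    where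
    pad : ∀ k → Σ (k ℕ.+ n) f ≈ Σ n f
    pad zero    = refl
    pad (suc k) = trans (+-cong (pad k) (vanish _ (s≤s (ℕ.m≤n+m n k)))) (+-identityʳ _)

  Kc : Carrier → Series
  Kc r zero    = r
  Kc r (suc _) = 0#

  0s 1s X : Series
  0s _  = 0#
  1s    = Kc 1#
  X 1   = 1#
  X _   = 0#

  infixl 6 _⊕_ _⊝_
  infixl 7 _⊛_

  _⊕_ : Series → Series → Series
  (a ⊕ b) n = a n + b n

  ⊖_ : Series → Series
  (⊖ a) n = - a n

  _⊝_ : Series → Series → Series
  a ⊝ b = a ⊕ (⊖ b)

  _⊛_ : Series → Series → Series
  (a ⊛ b) n = Σ n (λ i → a i * b (n ∸ i))

  sh : Series → Series
  sh a n = a (suc n)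

  ⊛-cong≤ : ∀ n {a a′ b b′ : Series} → (∀ i → i ≤ n → a i ≈ a′ i) → (∀ i → i ≤ n → b i ≈ b′ i)
          → (a ⊛ b) n ≈ (a′ ⊛ b′) n
  ⊛-cong≤ n a≈a′ b≈b′ = Σ-cong n (λ i i≤n → *-cong (a≈a′ i i≤n) (b≈b′ (n ∸ i) (m∸n≤m n i)))

  ⊛-cong : ∀ {a a′ b b′} → a ≐ a′ → b ≐ b′ → a ⊛ b ≐ a′ ⊛ b′
  ⊛-cong a≈a′ b≈b′ n = ⊛-cong≤ n (λ i _ → a≈a′ i) (λ i _ → b≈b′ i)

  ⊛-first : ∀ n a b → (a ⊛ b) (suc n) ≈ a 0 * b (suc n) + (sh a ⊛ b) n
  ⊛-first n a b = Σ-shift n (λ i → a i * b (suc n ∸ i))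

  ⊛-last : ∀ n a b → (a ⊛ b) (suc n) ≈ (a ⊛ sh b) n + a (suc n) * b 0
  ⊛-last n a b = +-cong (Σ-cong n (λ i i≤n → *-congˡ (reflexive (≡.cong b (ℕ.+-∸-assoc 1 i≤n)))))
                        (*-congˡ (reflexive (≡.cong b (n∸n≡0 (suc n)))))

  ⊛-comm : ∀ n a b → (a ⊛ b) n ≈ (b ⊛ a) n
  ⊛-comm zero    a b = *-comm _ _
  ⊛-comm (suc n) a b = begin
    (a ⊛ b) (suc n)                 ≈⟨ ⊛-first n a b ⟩
    a 0 * b (suc n) + (sh a ⊛ b) n  ≈⟨ +-cong (*-comm _ _) (⊛-comm n (sh a) b) ⟩
    b (suc n) * a 0 + (b ⊛ sh a) n  ≈⟨ +-comm _ _ ⟩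
    (b ⊛ sh a) n + b (suc n) * a 0  ≈⟨ sym (⊛-last n b a) ⟩
    (b ⊛ a) (suc n)                 ∎

  K⊛ : ∀ n r a → (Kc r ⊛ a) n ≈ r * a n
  K⊛ zero    r a = refl
  K⊛ (suc n) r a = begin
    (Kc r ⊛ a) (suc n)              ≈⟨ ⊛-first n (Kc r) a ⟩
    r * a (suc n) + (0s ⊛ a) n      ≈⟨ +-congˡ (Σ-zero n (λ i _ → zeroˡ _)) ⟩
    r * a (suc n) + 0#              ≈⟨ +-identityʳ _ ⟩
    r * a (suc n)                   ∎

  ⊛-distribˡ : ∀ n a b d → (a ⊛ (b ⊕ d)) n ≈ (a ⊛ b) n + (a ⊛ d) n
  ⊛-distribˡ n a b d = trans (Σ-cong n (λ i _ → distribˡ _ _ _)) (Σ-+ n _ _)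

  ⊛-distribʳ : ∀ n a b d → ((b ⊕ d) ⊛ a) n ≈ (b ⊛ a) n + (d ⊛ a) n
  ⊛-distribʳ n a b d = trans (Σ-cong n (λ i _ → distribʳ _ _ _)) (Σ-+ n _ _)

  ⊛-assoc : ∀ n a b d → ((a ⊛ b) ⊛ d) n ≈ (a ⊛ (b ⊛ d)) n
  ⊛-assoc zero    a b d = *-assoc _ _ _
  ⊛-assoc (suc n) a b d = begin
    ((a ⊛ b) ⊛ d) (suc n)                                  ≈⟨ ⊛-first n (a ⊛ b) d ⟩
    (a 0 * b 0) * d (suc n) + (sh (a ⊛ b) ⊛ d) n
      ≈⟨ +-congˡ (⊛-cong {b = d} (λ m → ⊛-first m a b) (λ _ → refl) n) ⟩
    (a 0 * b 0) * d (suc n) + ((a0·shb ⊕ (sh a ⊛ b)) ⊛ d) n ≈⟨ +-congˡ (⊛-distribʳ n d _ _) ⟩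
    (a 0 * b 0) * d (suc n) + ((a0·shb ⊛ d) n + ((sh a ⊛ b) ⊛ d) n)
      ≈⟨ +-congˡ (+-cong scale (⊛-assoc n (sh a) b d)) ⟩
    (a 0 * b 0) * d (suc n) + (a 0 * (sh b ⊛ d) n + (sh a ⊛ (b ⊛ d)) n)
      ≈⟨ solve 5 (λ p q r s t → (p :* q) :* r :+ (p :* s :+ t) := p :* (q :* r :+ s) :+ t) refl
           (a 0) (b 0) (d (suc n)) ((sh b ⊛ d) n) ((sh a ⊛ (b ⊛ d)) n) ⟩
    a 0 * (b 0 * d (suc n) + (sh b ⊛ d) n) + (sh a ⊛ (b ⊛ d)) n
      ≈⟨ +-congʳ (*-congˡ (sym (⊛-first n b d))) ⟩
    a 0 * (b ⊛ d) (suc n) + (sh a ⊛ (b ⊛ d)) n            ≈⟨ sym (⊛-first n a (b ⊛ d)) ⟩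
    (a ⊛ (b ⊛ d)) (suc n)                                  ∎
    where
    a0·shb : Series
    a0·shb i = a 0 * sh b i
    scale : (a0·shb ⊛ d) n ≈ a 0 * (sh b ⊛ d) n
    scale = trans (Σ-cong n (λ i _ → *-assoc _ _ _)) (sym (Σ-*ˡ n (a 0) _))

  open import Algebra.Structures using (IsCommutativeRing)
  import Algebra.Construct.Pointwise ℕ as Pointwise

  series-isCommutativeRing : IsCommutativeRing _≐_ _⊕_ _⊛_ ⊖_ 0s 1s
  series-isCommutativeRing = record
    { isRing = record
      { +-isAbelianGroup = Pointwise.isAbelianGroup +-isAbelianGroup
      ; *-cong     = ⊛-cong
      ; *-assoc    = λ a b d n → ⊛-assoc n a b d
      ; *-identity = (λ a n → trans (K⊛ n 1# a) (*-identityˡ _))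
                   , (λ a n → trans (⊛-comm n a 1s) (trans (K⊛ n 1# a) (*-identityˡ _)))
      ; distrib    = (λ a b d n → ⊛-distribˡ n a b d) , (λ a b d n → ⊛-distribʳ n a b d)
      }
    ; *-comm = λ a b n → ⊛-comm n a b
    }

  SeriesRing : CommutativeRing c ℓ
  SeriesRing = record { isCommutativeRing = series-isCommutativeRing }

  Kc-cong : ∀ {r s} → r ≈ s → Kc r ≐ Kc s
  Kc-cong r≈s zero    = r≈s
  Kc-cong r≈s (suc _) = refl

  Kc-0 : Kc 0# ≐ 0s
  Kc-0 zero    = refl
  Kc-0 (suc _) = refl

  Kc-+ : ∀ r s → Kc (r + s) ≐ Kc r ⊕ Kc s
  Kc-+ r s zero    = refl
  Kc-+ r s (suc _) = sym (+-identityʳ 0#)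

  Kc-⊖ : ∀ r → Kc (- r) ≐ ⊖ Kc r
  Kc-⊖ r zero    = refl
  Kc-⊖ r (suc _) = sym -0#≈0#
    where open import Algebra.Properties.Ring ring using (-0#≈0#)

  Kc-* : ∀ r s → Kc (r * s) ≐ Kc r ⊛ Kc s
  Kc-* r s zero    = refl
  Kc-* r s (suc n) = sym (trans (K⊛ (suc n) r (Kc s)) (zeroʳ r))


module PowerSeries {c ℓ} (R : CommutativeRing c ℓ) where
  open PowerSeriesRing R public
  open CommutativeRing R
  module S = CommutativeRing SeriesRing
  module ΣS = PowerSeriesRing SeriesRing using (Σ; Σ-cong; Σ-*ˡ; Σ-shift)
  open import Relation.Binary.Reasoning.Setoid S.setoid
  open import Algebra.Properties.Ring ring using (-0#≈0#)
  open IntegerCoefficientSolver SeriesRing using (solve; _:=_; _:+_; _:*_; _:-_; :1)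

  pow : Series → ℕ → Series
  pow a zero    = 1s
  pow a (suc k) = a ⊛ pow a k

  pow-unit : ∀ a → a 0 ≈ 1# → ∀ k → pow a k 0 ≈ 1#
  pow-unit a a0≈1 zero    = refl
  pow-unit a a0≈1 (suc k) = trans (*-cong a0≈1 (pow-unit a a0≈1 k)) (*-identityˡ 1#)

  -- a ≃[ n ] b : the coefficients of a and b agree below n, i.e. a ≡ b mod x^n
  infix 4 _≃[_]_
  _≃[_]_ : Series → ℕ → Series → Set ℓ
  a ≃[ n ] b = ∀ i → i < n → a i ≈ b i

  ≐⇒≃ : ∀ {n a b} → a ≐ b → a ≃[ n ] b
  ≐⇒≃ a≐b i _ = a≐b i

  ≃-refl : ∀ {n a} → a ≃[ n ] a
  ≃-refl _ _ = refl

  ≃-trans : ∀ {n a b d} → a ≃[ n ] b → b ≃[ n ] d → a ≃[ n ] d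
  ≃-trans a≃b b≃d i i<n = trans (a≃b i i<n) (b≃d i i<n)

  ≃-mono : ∀ {m n a b} → m ≤ n → a ≃[ n ] b → a ≃[ m ] b
  ≃-mono m≤n a≃b i i<m = a≃b i (≤-trans i<m m≤n)

  ≃-all : ∀ {a b} → (∀ n → a ≃[ suc n ] b) → a ≐ b
  ≃-all a≃b n = a≃b n n ≤-refl

  ⊕-≃ : ∀ {n a a′ b b′} → a ≃[ n ] a′ → b ≃[ n ] b′ → a ⊕ b ≃[ n ] a′ ⊕ b′
  ⊕-≃ a≃a′ b≃b′ i i<n = +-cong (a≃a′ i i<n) (b≃b′ i i<n)

  ⊖-≃ : ∀ {n a a′} → a ≃[ n ] a′ → ⊖ a ≃[ n ] ⊖ a′
  ⊖-≃ a≃a′ i i<n = -‿cong (a≃a′ i i<n)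

  ⊛-≃ : ∀ {n a a′ b b′} → a ≃[ n ] a′ → b ≃[ n ] b′ → a ⊛ b ≃[ n ] a′ ⊛ b′
  ⊛-≃ a≃a′ b≃b′ i i<n =
    ⊛-cong≤ i (λ j j≤i → a≃a′ j (≤-trans (s≤s j≤i) i<n)) (λ j j≤i → b≃b′ j (≤-trans (s≤s j≤i) i<n))

  pow-≃ : ∀ {n a b} k → a ≃[ n ] b → pow a k ≃[ n ] pow b k
  pow-≃ zero    a≃b = ≃-refl
  pow-≃ (suc k) a≃b = ⊛-≃ a≃b (pow-≃ k a≃b)

  ⊛-const-zeroˡ : ∀ a b → a 0 ≈ 0# → (a ⊛ b) 0 ≈ 0#
  ⊛-const-zeroˡ a b a0≈0 = trans (*-congʳ a0≈0) (zeroˡ _)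

  ⊛-const-zeroʳ : ∀ a b → b 0 ≈ 0# → (a ⊛ b) 0 ≈ 0#
  ⊛-const-zeroʳ a b b0≈0 = trans (*-congˡ b0≈0) (zeroʳ _)

  ⊛-≃-raise : ∀ {n h a b} → h 0 ≈ 0# → a ≃[ n ] b → h ⊛ a ≃[ suc n ] h ⊛ b
  ⊛-≃-raise {n} {h} {a} {b} h0≈0 a≃b = raised
    where
    killed : ∀ x y → h 0 * x ≈ h 0 * y
    killed x y = trans (*-congʳ h0≈0) (trans (zeroˡ x) (sym (trans (*-congʳ h0≈0) (zeroˡ y))))
    raised : h ⊛ a ≃[ suc n ] h ⊛ b
    raised zero    _         = killed (a 0) (b 0)
    raised (suc i) (s≤s i<n) = trans (⊛-first i h a)
      (trans (+-cong (killed _ _) (⊛-cong≤ i (λ _ _ → refl) (λ j j≤i → a≃b j (≤-trans (s≤s j≤i) i<n))))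
             (sym (⊛-first i h b)))

  pow-order : ∀ {u} → u 0 ≈ 0# → ∀ k → pow u k ≃[ k ] 0s
  pow-order u0≈0 zero    i ()
  pow-order u0≈0 (suc k) = ≃-trans (⊛-≃-raise u0≈0 (pow-order u0≈0 k)) (≐⇒≃ (S.zeroʳ _))

  sh-X : sh X ≐ 1s
  sh-X zero    = refl
  sh-X (suc _) = refl

  X⊛-suc : ∀ n a → (X ⊛ a) (suc n) ≈ a n
  X⊛-suc n a = trans (⊛-first n X a)
    (trans (+-cong (zeroˡ _) (trans (⊛-cong {b = a} sh-X (λ _ → refl) n) (S.*-identityˡ a n))) (+-identityˡ _))

  -- the inverse of a series a with a 0 ≈ 1 is 1/a = Σ_k (1 - a)^k; since
  -- (1 - a)^k ≡ 0 mod x^k, only the terms k ≤ n contribute to x^n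
  inv : Series → Series
  inv a n = Σ n (λ k → pow (1s ⊝ a) k n)

  inv-≃ : ∀ {n a b} → a ≃[ n ] b → inv a ≃[ n ] inv b
  inv-≃ a≃b i i<n = Σ-cong i (λ k _ → pow-≃ k (⊕-≃ ≃-refl (⊖-≃ a≃b)) i i<n)

  ΣS-coeff : ∀ N (F : ℕ → Series) n → ΣS.Σ N F n ≈ Σ N (λ k → F k n)
  ΣS-coeff zero    F n = refl
  ΣS-coeff (suc N) F n = +-congʳ (ΣS-coeff N F n)

  geometric : ∀ a n → a ⊛ ΣS.Σ n (pow (1s ⊝ a)) ≐ 1s ⊝ pow (1s ⊝ a) (suc n)
  geometric a zero    = solve 1 (λ x → x :* :1 := :1 :- (:1 :- x) :* :1) S.refl a
  geometric a (suc n) = begin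
    a ⊛ (ΣS.Σ n (pow u) ⊕ pow u (suc n))     ≈⟨ S.distribˡ a (ΣS.Σ n (pow u)) (pow u (suc n)) ⟩
    a ⊛ ΣS.Σ n (pow u) ⊕ a ⊛ pow u (suc n)   ≈⟨ S.+-congʳ (geometric a n) ⟩
    (1s ⊝ pow u (suc n)) ⊕ a ⊛ pow u (suc n) ≈⟨ solve 2 (λ x p → (:1 :- p) :+ x :* p := :1 :- (:1 :- x) :* p) S.refl a (pow u (suc n)) ⟩
    1s ⊝ u ⊛ pow u (suc n)                   ∎
    where u = 1s ⊝ a

  inv-right : ∀ a → a 0 ≈ 1# → a ⊛ inv a ≐ 1s
  inv-right a a0≈1 n = trans (⊛-cong≤ n (λ _ _ → refl) inv≈partial)
                             (trans (geometric a n n) (trans (+-congˡ remainder) (+-identityʳ _)))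
    where
    u = 1s ⊝ a
    u-order : ∀ k → pow u k ≃[ k ] 0s
    u-order = pow-order (trans (+-congˡ (-‿cong a0≈1)) (-‿inverseʳ 1#))
    inv≈partial : ∀ i → i ≤ n → inv a i ≈ ΣS.Σ n (pow u) i
    inv≈partial i i≤n = sym (trans (ΣS-coeff n (pow u) i) (Σ-extend (λ k → pow u k i) i≤n (λ k i<k → u-order k i i<k)))
    remainder : - pow u (suc n) n ≈ 0#
    remainder = trans (-‿cong (u-order (suc n) n ≤-refl)) -0#≈0#

  inv-left : ∀ a → a 0 ≈ 1# → inv a ⊛ a ≐ 1s
  inv-left a a0≈1 = S.trans (S.*-comm (inv a) a) (inv-right a a0≈1)

  open import Algebra.Properties.Monoid S.*-monoid using (cancelˡ)

  inverse-unique : ∀ {a b b′} → a ⊛ b ≐ 1s → a ⊛ b′ ≐ 1s → b ≐ b′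
  inverse-unique {a} {b} {b′} ab≐1 ab′≐1 = begin
    b             ≈⟨ S.sym (S.*-identityʳ b) ⟩
    b ⊛ 1s        ≈⟨ S.*-congˡ (S.sym ab′≐1) ⟩
    b ⊛ (a ⊛ b′)  ≈⟨ cancelˡ (S.trans (S.*-comm b a) ab≐1) b′ ⟩
    b′            ∎

  unit-cancel-≃ : ∀ {n h a b} → h 0 ≈ 1# → h ⊛ a ≃[ n ] h ⊛ b → a ≃[ n ] b
  unit-cancel-≃ {h = h} {a} {b} h0≈1 ha≃hb =
    ≃-trans (≐⇒≃ (S.sym (cancelˡ (inv-left h h0≈1) a)))
            (≃-trans (⊛-≃ ≃-refl ha≃hb) (≐⇒≃ (cancelˡ (inv-left h h0≈1) b)))

  -- One level of the continued fractions of the theorem, in a variable h: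
  --   cfStep h α β t = 1 - α h - β h² t ,
  -- so that 1 / cfStep h α β t is the fraction whose tail is t.
  cfStep : Series → Carrier → Carrier → Series → Series
  cfStep h α β t = 1s ⊝ Kc α ⊛ h ⊝ Kc β ⊛ pow h 2 ⊛ t

  module _ (h : Series) (h0≈0 : h 0 ≈ 0#) (α β : Carrier) where

    private
      βh²0≈0 : (Kc β ⊛ pow h 2) 0 ≈ 0#
      βh²0≈0 = ⊛-const-zeroʳ (Kc β) (pow h 2) (⊛-const-zeroˡ h (pow h 1) h0≈0)

    cfStep-unit : ∀ t → cfStep h α β t 0 ≈ 1#
    cfStep-unit t = trans (+-cong (+-congˡ (vanish (⊛-const-zeroʳ (Kc α) h h0≈0)))
                                  (vanish (⊛-const-zeroˡ (Kc β ⊛ pow h 2) t βh²0≈0)))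
                          (trans (+-identityʳ _) (+-identityʳ _))
      where
      vanish : ∀ {z} → z ≈ 0# → - z ≈ 0#
      vanish z≈0 = trans (-‿cong z≈0) -0#≈0#

    -- the tail enters multiplied by h², so agreement of tails improves
    cfStep-≃ : ∀ {n t t′} → t ≃[ n ] t′ → cfStep h α β t ≃[ suc n ] cfStep h α β t′
    cfStep-≃ t≃t′ = ⊕-≃ ≃-refl (⊖-≃ (⊛-≃-raise βh²0≈0 t≃t′))

    -- the equation  a · cfStep h α β a = 1  has at most one solution:
    -- (a - b) · cfStep h α β (a + b) = a · cfStep h α β a - b · cfStep h α β b
    cfStep-root-unique : ∀ {a b} → a ⊛ cfStep h α β a ≐ 1s → b ⊛ cfStep h α β b ≐ 1s → a ≐ b
    cfStep-root-unique {a} {b} a-root b-root = x∙y⁻¹≈ε⇒x≈y a b (≃-all (λ n →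
      unit-cancel-≃ (cfStep-unit (a ⊕ b)) (≐⇒≃ (S.trans (S.*-comm _ _) difference))))
      where
      open import Algebra.Properties.Group S.+-group using (x∙y⁻¹≈ε⇒x≈y)
      p = Kc α ⊛ h
      q = Kc β ⊛ pow h 2
      difference : (a ⊝ b) ⊛ cfStep h α β (a ⊕ b) ≐ cfStep h α β (a ⊕ b) ⊛ 0s
      difference = begin
        (a ⊝ b) ⊛ cfStep h α β (a ⊕ b)
          ≈⟨ solve 4 (λ a b p q → (a :- b) :* (:1 :- p :- q :* (a :+ b))
                             := a :* (:1 :- p :- q :* a) :- b :* (:1 :- p :- q :* b)) S.refl a b p q ⟩
        a ⊛ cfStep h α β a ⊝ b ⊛ cfStep h α β b ≈⟨ S.+-cong a-root (S.-‿cong b-root) ⟩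
        1s ⊝ 1s                                   ≈⟨ S.-‿inverseʳ 1s ⟩
        0s                                        ≈⟨ S.sym (S.zeroʳ _) ⟩
        cfStep h α β (a ⊕ b) ⊛ 0s                 ∎

  open import Algebra.Properties.CommutativeSemigroup S.*-commutativeSemigroup using (x∙yz≈y∙xz)

  -- Substitution x ↦ f of a series f without constant term:
  --   comp V n = Σ_{k≤n} V k · (f^k)_n ,
  -- exact since f^k ≡ 0 mod x^k.

  module Substitution (f : Series) (f0≈0 : f 0 ≈ 0#) where

    comp : Series → Series
    comp V n = Σ n (λ k → V k * pow f k n)

    partial : ℕ → Series → Series
    partial N V = ΣS.Σ N (λ k → Kc (V k) ⊛ pow f k)

    comp≈partial : ∀ N V n → n ≤ N → comp V n ≈ partial N V n
    comp≈partial N V n n≤N = sym (trans (ΣS-coeff N _ n) (trans (Σ-cong N (λ k _ → K⊛ n (V k) (pow f k)))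
      (Σ-extend (λ k → V k * pow f k n) n≤N (λ k n<k → trans (*-congˡ (pow-order f0≈0 k n n<k)) (zeroʳ _)))))

    partial-step : ∀ N V → partial (suc N) V ≐ Kc (V 0) ⊕ f ⊛ partial N (sh V)
    partial-step N V = begin
      partial (suc N) V                                         ≈⟨ ΣS.Σ-shift N (λ k → Kc (V k) ⊛ pow f k) ⟩
      Kc (V 0) ⊛ 1s ⊕ ΣS.Σ N (λ i → Kc (V (suc i)) ⊛ (f ⊛ pow f i))
        ≈⟨ S.+-cong (S.*-identityʳ (Kc (V 0))) (ΣS.Σ-cong N (λ i _ → x∙yz≈y∙xz (Kc (V (suc i))) f (pow f i))) ⟩
      Kc (V 0) ⊕ ΣS.Σ N (λ i → f ⊛ (Kc (V (suc i)) ⊛ pow f i)) ≈⟨ S.+-congˡ (S.sym (ΣS.Σ-*ˡ N f _)) ⟩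
      Kc (V 0) ⊕ f ⊛ partial N (sh V)                           ∎

    comp-step : ∀ V → comp V ≐ Kc (V 0) ⊕ f ⊛ comp (sh V)
    comp-step V n = trans (comp≈partial (suc n) V n (n≤1+n n)) (trans (partial-step n V n)
      (+-congˡ (⊛-cong≤ n (λ _ _ → refl) (λ i i≤n → sym (comp≈partial n (sh V) i i≤n)))))

    comp-const : ∀ V → comp V 0 ≈ V 0
    comp-const V = *-identityʳ _

    comp-cong : ∀ {V W} → V ≐ W → comp V ≐ comp W
    comp-cong V≐W n = Σ-cong n (λ k _ → *-congʳ (V≐W k))

    comp-+ : ∀ V W → comp (V ⊕ W) ≐ comp V ⊕ comp W
    comp-+ V W n = trans (Σ-cong n (λ k _ → distribʳ _ _ _)) (Σ-+ n _ _)

    comp-K : ∀ r V → comp (Kc r ⊛ V) ≐ Kc r ⊛ comp V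
    comp-K r V n = trans (Σ-cong n (λ k _ → trans (*-congʳ (K⊛ k r V)) (*-assoc _ _ _)))
                         (trans (sym (Σ-*ˡ n r _)) (sym (K⊛ n r (comp V))))

    comp-0 : comp 0s ≐ 0s
    comp-0 n = Σ-zero n (λ k _ → zeroˡ _)

    comp-Kc : ∀ r → comp (Kc r) ≐ Kc r
    comp-Kc r = begin
      comp (Kc r)                  ≈⟨ comp-step (Kc r) ⟩
      Kc r ⊕ f ⊛ comp (sh (Kc r))  ≈⟨ S.+-congˡ (S.*-congˡ (S.trans (comp-cong {sh (Kc r)} {0s} (λ _ → refl)) comp-0)) ⟩
      Kc r ⊕ f ⊛ 0s                ≈⟨ S.+-congˡ (S.zeroʳ f) ⟩
      Kc r ⊕ 0s                    ≈⟨ S.+-identityʳ (Kc r) ⟩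
      Kc r                         ∎

    comp-X : comp X ≐ f
    comp-X = begin
      comp X                    ≈⟨ comp-step X ⟩
      Kc 0# ⊕ f ⊛ comp (sh X)   ≈⟨ S.+-cong Kc-0 (S.*-congˡ (S.trans (comp-cong sh-X) (comp-Kc 1#))) ⟩
      0s ⊕ f ⊛ 1s               ≈⟨ S.+-identityˡ _ ⟩
      f ⊛ 1s                    ≈⟨ S.*-identityʳ f ⟩
      f                         ∎

    -- substitution is multiplicative; by Horner's rule the agreement of
    -- both sides goes up by one order with every step
    comp-⊛-≃ : ∀ n V W → comp (V ⊛ W) ≃[ n ] comp V ⊛ comp W
    comp-⊛-≃ zero    V W i ()
    comp-⊛-≃ (suc n) V W =
      ≃-trans (≐⇒≃ (comp-step (V ⊛ W))) (≃-trans (⊕-≃ ≃-refl (⊛-≃-raise f0≈0 tail≃)) (≐⇒≃ horner))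
      where
      v w : Series
      v = comp (sh V)
      w = comp (sh W)
      sh-⊛ : sh (V ⊛ W) ≐ Kc (V 0) ⊛ sh W ⊕ sh V ⊛ W
      sh-⊛ m = trans (⊛-first m V W) (+-congʳ (sym (K⊛ m (V 0) (sh W))))
      tail≃ : comp (sh (V ⊛ W)) ≃[ n ] Kc (V 0) ⊛ w ⊕ v ⊛ comp W
      tail≃ = ≃-trans (≐⇒≃ (S.trans (comp-cong sh-⊛) (S.trans (comp-+ _ _) (S.+-congʳ (comp-K (V 0) (sh W))))))
                      (⊕-≃ ≃-refl (comp-⊛-≃ n (sh V) W))
      horner : Kc (V 0 * W 0) ⊕ f ⊛ (Kc (V 0) ⊛ w ⊕ v ⊛ comp W) ≐ comp V ⊛ comp W
      horner = begin
        Kc (V 0 * W 0) ⊕ f ⊛ (Kc (V 0) ⊛ w ⊕ v ⊛ comp W)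
          ≈⟨ S.+-cong (Kc-* (V 0) (W 0)) (S.*-congˡ {f} (S.+-congˡ {Kc (V 0) ⊛ w} (S.*-congˡ {v} (comp-step W)))) ⟩
        Kc (V 0) ⊛ Kc (W 0) ⊕ f ⊛ (Kc (V 0) ⊛ w ⊕ v ⊛ (Kc (W 0) ⊕ f ⊛ w))
          ≈⟨ solve 5 (λ kv kw f v w → kv :* kw :+ f :* (kv :* w :+ v :* (kw :+ f :* w)) := (kv :+ f :* v) :* (kw :+ f :* w))
                   S.refl (Kc (V 0)) (Kc (W 0)) f v w ⟩
        (Kc (V 0) ⊕ f ⊛ v) ⊛ (Kc (W 0) ⊕ f ⊛ w) ≈⟨ S.sym (S.*-cong (comp-step V) (comp-step W)) ⟩
        comp V ⊛ comp W ∎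

    comp-⊛ : ∀ V W → comp (V ⊛ W) ≐ comp V ⊛ comp W
    comp-⊛ V W = ≃-all (λ n → comp-⊛-≃ (suc n) V W)

    comp-⊝ : ∀ V W → comp (V ⊝ W) ≐ comp V ⊝ comp W
    comp-⊝ V W = S.trans (comp-+ V (⊖ W)) (S.+-congˡ comp-⊖)
      where
      open import Algebra.Properties.Group S.+-group using (inverseˡ-unique)
      comp-⊖ : comp (⊖ W) ≐ ⊖ comp W
      comp-⊖ = inverseˡ-unique _ _ (S.trans (S.sym (comp-+ (⊖ W) W)) (S.trans (comp-cong (S.-‿inverseˡ W)) comp-0))

    comp-pow-X : ∀ k → comp (pow X k) ≐ pow f k
    comp-pow-X zero    = comp-Kc 1#
    comp-pow-X (suc k) = S.trans (comp-⊛ X (pow X k)) (S.*-cong comp-X (comp-pow-X k))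

    comp-cfStep : ∀ α β t → comp (cfStep X α β t) ≐ cfStep f α β (comp t)
    comp-cfStep α β t = begin
      comp (1s ⊝ Kc α ⊛ X ⊝ Kc β ⊛ pow X 2 ⊛ t)
        ≈⟨ S.trans (comp-⊝ _ _) (S.+-congʳ (comp-⊝ _ _)) ⟩
      comp 1s ⊝ comp (Kc α ⊛ X) ⊝ comp (Kc β ⊛ pow X 2 ⊛ t)
        ≈⟨ S.+-cong (S.+-cong (comp-Kc 1#) (S.-‿cong (S.trans (comp-K α X) (S.*-congˡ comp-X))))
                    (S.-‿cong (S.trans (comp-⊛ _ t) (S.*-congʳ {comp t} (S.trans (comp-K β _) (S.*-congˡ (comp-pow-X 2)))))) ⟩
      1s ⊝ Kc α ⊛ f ⊝ Kc β ⊛ pow f 2 ⊛ comp t ∎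

    comp-cfStep-inverse : ∀ {a t} α β → a ⊛ cfStep X α β t ≐ 1s → comp a ⊛ cfStep f α β (comp t) ≐ 1s
    comp-cfStep-inverse {a} {t} α β a-inverse = begin
      comp a ⊛ cfStep f α β (comp t) ≈⟨ S.*-congˡ (S.sym (comp-cfStep α β t)) ⟩
      comp a ⊛ comp (cfStep X α β t) ≈⟨ S.sym (comp-⊛ a _) ⟩
      comp (a ⊛ cfStep X α β t)      ≈⟨ comp-cong a-inverse ⟩
      comp 1s                        ≈⟨ comp-Kc 1# ⟩
      1s                             ∎

    riordan-apply : ∀ g V i → Σ i (λ k → (g ⊛ pow f k) i * V k) ≈ (g ⊛ comp V) i
    riordan-apply g V i = sym (trans (⊛-cong≤ i (λ _ _ → refl) (λ j j≤i → comp≈partial i V j j≤i))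
      (trans (ΣS.Σ-*ˡ i g (λ k → Kc (V k) ⊛ pow f k) i)
      (trans (ΣS-coeff i (λ k → g ⊛ (Kc (V k) ⊛ pow f k)) i)
      (Σ-cong i (λ k _ → trans (x∙yz≈y∙xz g (Kc (V k)) (pow f k) i)
                               (trans (K⊛ i (V k) (g ⊛ pow f k)) (*-comm _ _)))))))

    module Injectivity {h : Series} (h0≈1 : h 0 ≈ 1#) (f≐Xh : f ≐ X ⊛ h) where
      open import Algebra.Properties.Group +-group using (∙-cancelˡ)

      f-cancel-≃ : ∀ {n a b} → f ⊛ a ≃[ suc n ] f ⊛ b → a ≃[ n ] b
      f-cancel-≃ {a = a} {b} fa≃fb = unit-cancel-≃ h0≈1 (λ i i<n →
        trans (sym (divide-by-X a i)) (trans (fa≃fb (suc i) (s≤s i<n)) (divide-by-X b i)))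
        where
        divide-by-X : ∀ a i → (f ⊛ a) (suc i) ≈ (h ⊛ a) i
        divide-by-X a i = trans (S.*-congʳ {a} f≐Xh (suc i)) (trans (S.*-assoc X h a (suc i)) (X⊛-suc i (h ⊛ a)))

      const≈ : ∀ {n} V W → comp V ≃[ suc n ] comp W → V 0 ≈ W 0
      const≈ V W V∘f≃W∘f = trans (sym (comp-const V)) (trans (V∘f≃W∘f 0 (s≤s z≤n)) (comp-const W))

      comp-injective-≃ : ∀ n V W → comp V ≃[ n ] comp W → V ≃[ n ] W
      comp-injective-≃ zero    V W _       i ()
      comp-injective-≃ (suc n) V W V∘f≃W∘f zero    _         = const≈ V W V∘f≃W∘f
      comp-injective-≃ (suc n) V W V∘f≃W∘f (suc i) (s≤s i<n) =
        comp-injective-≃ n (sh V) (sh W) (f-cancel-≃ tails≃) i i<n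
        where
        -- by Horner's rule, after cancelling the equal constant terms
        tails≃ : f ⊛ comp (sh V) ≃[ suc n ] f ⊛ comp (sh W)
        tails≃ j j<n = ∙-cancelˡ (Kc (V 0) j) _ _ (trans (sym (comp-step V j)) (trans (V∘f≃W∘f j j<n)
          (trans (comp-step W j) (+-congʳ (Kc-cong (sym (const≈ V W V∘f≃W∘f)) j)))))

      comp-injective : ∀ {V W} → comp V ≐ comp W → V ≐ W
      comp-injective {V} {W} V∘f≐W∘f = ≃-all (λ n → comp-injective-≃ (suc n) V W (≐⇒≃ V∘f≐W∘f))

  module Limit (s : ℕ → Series) (cauchy : ∀ k → s (suc k) ≃[ k ] s k) where

    lim : Series
    lim n = s (suc n) n

    private
      stable : ∀ j i → s (j ℕ.+ suc i) i ≈ lim i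
      stable zero    i = refl
      stable (suc j) i = trans (cauchy (j ℕ.+ suc i) i (ℕ.m≤n+m (suc i) j)) (stable j i)

    lim-≃ : ∀ {n k} → n ≤ k → s k ≃[ n ] lim
    lim-≃ {k = k} n≤k i i<n =
      ≡.subst (λ k′ → s k′ i ≈ lim i) (m∸n+n≡m (≤-trans i<n n≤k)) (stable (k ∸ suc i) i)

    lim-fixed : (F : Series → Series) → (∀ {n a b} → a ≃[ n ] b → F a ≃[ n ] F b)
              → (∀ k → s (suc k) ≐ F (s k)) → lim ≐ F lim
    lim-fixed F F-≃ iterate n = trans (sym (lim-≃ (n≤1+n (suc n)) n ≤-refl))
                                      (trans (iterate (suc n) n) (F-≃ (lim-≃ ≤-refl) n ≤-refl))

-- A polynomial of Defs is the coefficient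
-- sequence of a power series over ℤ, so ℤ[y] is modelled by the ring
-- Poly of such series, and the series of Defs are power series over
-- Poly.

module ℤ[[y]] = PowerSeriesRing ℤ.+-*-commutativeRing

Poly : CommutativeRing _ _
Poly = ℤ[[y]].SeriesRing

module Poly = CommutativeRing Poly
open PowerSeries Poly

sumTo≡Σ : ∀ n f → sumTo n f ≡ ℤ[[y]].Σ n f
sumTo≡Σ zero    f = ≡.refl
sumTo≡Σ (suc n) f = ≡.cong (ℤ._+ f (suc n)) (sumTo≡Σ n f)

sumTo-cong : ∀ n {f g : ℕ → ℤ} → (∀ i → f i ≡ g i) → sumTo n f ≡ sumTo n g
sumTo-cong zero    f≡g = f≡g 0
sumTo-cong (suc n) f≡g = ≡.cong₂ ℤ._+_ (sumTo-cong n f≡g) (f≡g (suc n))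

*P≡⊛ : ∀ a b m → (a *P b) m ≡ (a ℤ[[y]].⊛ b) m
*P≡⊛ a b m = sumTo≡Σ m _

sumToP≡Σ : ∀ n (F : ℕ → P) m → sumToP n F m ≡ Σ n F m
sumToP≡Σ zero    F m = ≡.refl
sumToP≡Σ (suc n) F m = ≡.cong (ℤ._+ F (suc n) m) (sumToP≡Σ n F m)

*S≐⊛ : ∀ {a a′ b b′} → a ≐ a′ → b ≐ b′ → a *S b ≐ a′ ⊛ b′
*S≐⊛ {a} {a′} {b} {b′} a≐a′ b≐b′ n m =
  ≡.trans (sumTo-cong n (λ i → *P≡⊛ (a i) (b (n ∸ i)) m))
        (≡.trans (sumToP≡Σ n (λ i → a i ℤ[[y]].⊛ b (n ∸ i)) m) (⊛-cong a≐a′ b≐b′ n m))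

+S≐⊕ : ∀ {a a′ b b′} → a ≐ a′ → b ≐ b′ → a +S b ≐ a′ ⊕ b′
+S≐⊕ a≐a′ b≐b′ n m = ≡.cong₂ ℤ._+_ (a≐a′ n m) (b≐b′ n m)

-S≐⊝ : ∀ {a a′ b b′} → a ≐ a′ → b ≐ b′ → a -S b ≐ a′ ⊝ b′
-S≐⊝ a≐a′ b≐b′ n m = ≡.cong₂ ℤ._+_ (a≐a′ n m) (≡.cong ℤ.-_ (b≐b′ n m))

1S≐1s : 1S ≐ 1s
1S≐1s zero    zero    = ≡.refl
1S≐1s zero    (suc m) = ≡.refl
1S≐1s (suc n) m       = ≡.refl

xS≐X : xS ≐ X
xS≐X zero          m       = ≡.refl
xS≐X (suc zero)    zero    = ≡.refl
xS≐X (suc zero)    (suc m) = ≡.refl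
xS≐X (suc (suc n)) m       = ≡.refl

K≐Kc : ∀ p → K p ≐ Kc p
K≐Kc p zero    m = ≡.refl
K≐Kc p (suc n) m = ≡.refl

powS≐pow : ∀ {a b} k → a ≐ b → powS a k ≐ pow b k
powS≐pow zero    a≐b = 1S≐1s
powS≐pow (suc k) a≐b = *S≐⊛ a≐b (powS≐pow k a≐b)

invS≐inv : ∀ {a b} → a ≐ b → invS a ≐ inv b
invS≐inv {a} {b} a≐b n m = ≡.trans (sumTo-cong n (λ k → powS≐pow k (-S≐⊝ 1S≐1s a≐b) n m))
                                 (sumToP≡Σ n (λ k → pow (1s ⊝ b) k n) m)

y two : Poly.Carrier
y   = yP
two = Poly.1# Poly.+ Poly.1#

σ f numerator g : Series
σ = pow (1s ⊕ X) 2
f = X ⊛ inv σ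
numerator = 1s ⊕ Kc y ⊛ X ⊕ Kc y ⊛ pow X 2
g = numerator ⊛ inv σ

α β : Poly.Carrier
α = two Poly.- y
β = Poly.1# Poly.- y

D E : Series → Series
D = cfStep X two Poly.1#
E = cfStep X α β

tail : ℕ → Series
tail zero    = 0s
tail (suc k) = inv (D (tail k))

convergent : ℕ → Series
convergent k = inv (E (tail k))

K2≐Kc : K (cP (ℤ.+ 2)) ≐ Kc two
K2≐Kc zero    zero    = ≡.refl
K2≐Kc zero    (suc m) = ≡.refl
K2≐Kc (suc n) m       = ≡.refl

K2-y≐Kc : K (cP (ℤ.+ 2) +P (-P yP)) ≐ Kc α
K2-y≐Kc zero    zero          = ≡.refl
K2-y≐Kc zero    (suc zero)    = ≡.refl
K2-y≐Kc zero    (suc (suc m)) = ≡.refl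
K2-y≐Kc (suc n) m             = ≡.refl

K1-y≐Kc : K (1P +P (-P yP)) ≐ Kc β
K1-y≐Kc zero    zero          = ≡.refl
K1-y≐Kc zero    (suc zero)    = ≡.refl
K1-y≐Kc zero    (suc (suc m)) = ≡.refl
K1-y≐Kc (suc n) m             = ≡.refl

σ-translation : onePlusXSq ≐ σ
σ-translation = powS≐pow 2 (+S≐⊕ 1S≐1s xS≐X)

Lmat≡ : ∀ n k m → Lmat n k m ≡ (g ⊛ pow f k) n m
Lmat≡ n k = *S≐⊛ gL≐g (powS≐pow k fL≐f) n
  where
  gL≐g : gL ≐ g
  gL≐g = *S≐⊛ (+S≐⊕ (+S≐⊕ 1S≐1s (*S≐⊛ (K≐Kc yP) xS≐X)) (*S≐⊛ (K≐Kc yP) (powS≐pow 2 xS≐X)))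
               (invS≐inv σ-translation)
  fL≐f : fL ≐ f
  fL≐f = *S≐⊛ xS≐X (invS≐inv σ-translation)

tailCF≐tail : ∀ k → tailCF k ≐ tail k
tailCF≐tail zero    n m = ≡.refl
tailCF≐tail (suc k) = invS≐inv (-S≐⊝ (-S≐⊝ 1S≐1s (*S≐⊛ K2≐Kc xS≐X))
                                     (*S≐⊛ x²≐1·x² (tailCF≐tail k)))
  where
  x²≐1·x² : powS xS 2 ≐ Kc Poly.1# ⊛ pow X 2
  x²≐1·x² = S.trans (powS≐pow 2 xS≐X) (S.sym (S.*-identityˡ (pow X 2)))

convCF≐convergent : ∀ k → convCF k ≐ convergent k
convCF≐convergent k = invS≐inv (-S≐⊝ (-S≐⊝ 1S≐1s (*S≐⊛ K2-y≐Kc xS≐X))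
                                      (*S≐⊛ (*S≐⊛ K1-y≐Kc (powS≐pow 2 xS≐X)) (tailCF≐tail k)))

X0≈0 : X 0 Poly.≈ Poly.0#
X0≈0 = Poly.refl

-- successive tails agree to increasing order, since the tail enters with x²
tail-cauchy : ∀ k → tail (suc k) ≃[ k ] tail k
tail-cauchy zero    = λ _ ()
tail-cauchy (suc k) = inv-≃ (cfStep-≃ X X0≈0 two Poly.1# (tail-cauchy k))

open Limit tail tail-cauchy renaming (lim to T; lim-≃ to tail-≃T)

T-root : T ⊛ D T ≐ 1s
T-root = S.trans (S.*-congʳ {D T} T-fixed) (inv-left (D T) (cfStep-unit X X0≈0 two Poly.1# T))
  where
  T-fixed : T ≐ inv (D T)
  T-fixed = lim-fixed (λ t → inv (D t)) (λ t≃t′ → inv-≃ (≃-mono (n≤1+n _) (cfStep-≃ X X0≈0 two Poly.1# t≃t′)))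
                      (λ _ → S.refl)

W : Series
W = inv (E T)

W-inverse : W ⊛ E T ≐ 1s
W-inverse = inv-left (E T) (cfStep-unit X X0≈0 α β T)

convergent-≃W : ∀ {n k} → n ≤ k → convergent k ≃[ n ] W
convergent-≃W n≤k = inv-≃ (≃-mono (n≤1+n _) (cfStep-≃ X X0≈0 α β (tail-≃T n≤k)))

-- Substituting f = x/(1+x)²: since f·σ = x, σ solves the substituted
-- tail equation  σ · (1 - 2f - f² σ) = 1, and so does T(f); hence T(f) = σ,
-- and then  W(f) · g = W(f) · (1 - (2-y)f - (1-y)f² σ) = 1.

σ-unit : σ 0 Poly.≈ Poly.1#
σ-unit = pow-unit (1s ⊕ X) (Poly.+-identityʳ Poly.1#) 2

f0≈0 : f 0 Poly.≈ Poly.0#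
f0≈0 = ⊛-const-zeroˡ X (inv σ) X0≈0

open Substitution f f0≈0
open Injectivity {h = inv σ} Poly.refl S.refl

f⊛σ≐X : f ⊛ σ ≐ X
f⊛σ≐X = S.trans (S.*-assoc X (inv σ) σ) (S.trans (S.*-congˡ {X} (inv-left σ σ-unit)) (S.*-identityʳ X))

open IntegerCoefficientSolver SeriesRing using (solve; _:=_; _:+_; _:*_; _:-_; :1; :2)
import Relation.Binary.Reasoning.Setoid S.setoid as SeriesReasoning

Kc-two : Kc two ≐ 1s ⊕ 1s
Kc-two = Kc-+ Poly.1# Poly.1#

-- σ · (1 - 2f - f²σ) = σ - 2x - x² = 1
σ-root : σ ⊛ cfStep f two Poly.1# σ ≐ 1s
σ-root = begin
  σ ⊛ cfStep f two Poly.1# σ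
    ≈⟨ solve 3 (λ s f k → s :* (:1 :- k :* f :- :1 :* (f :* (f :* :1)) :* s)
                       := s :- k :* (f :* s) :- (f :* s) :* (f :* s)) S.refl σ f (Kc two) ⟩
  σ ⊝ Kc two ⊛ (f ⊛ σ) ⊝ (f ⊛ σ) ⊛ (f ⊛ σ)
    ≈⟨ S.+-cong (S.+-congˡ {σ} (S.-‿cong (S.*-cong Kc-two f⊛σ≐X))) (S.-‿cong (S.*-cong f⊛σ≐X f⊛σ≐X)) ⟩
  σ ⊝ (1s ⊕ 1s) ⊛ X ⊝ X ⊛ X
    ≈⟨ solve 1 (λ x → (:1 :+ x) :* ((:1 :+ x) :* :1) :- :2 :* x :- x :* x
                   := :1) S.refl X ⟩
  1s ∎
  where open SeriesReasoning

T∘f≐σ : comp T ≐ σ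
T∘f≐σ = cfStep-root-unique f f0≈0 two Poly.1# (comp-cfStep-inverse {T} {T} two Poly.1# T-root) σ-root

head-at-σ : cfStep f α β σ ≐ g
head-at-σ = begin
  cfStep f α β σ                ≈⟨ S.sym (cancelʳ {σ} {inv σ} (inv-right σ σ-unit) _) ⟩
  (cfStep f α β σ ⊛ σ) ⊛ inv σ  ≈⟨ S.*-congʳ {inv σ} times-σ ⟩
  g                             ∎
  where
  open SeriesReasoning
  open import Algebra.Properties.Monoid S.*-monoid using (cancelʳ)
  Y = Kc y
  times-σ : cfStep f α β σ ⊛ σ ≐ numerator
  times-σ = begin
    cfStep f α β σ ⊛ σ
      ≈⟨ solve 4 (λ s f a b → (:1 :- a :* f :- b :* (f :* (f :* :1)) :* s) :* s
                         := s :- a :* (f :* s) :- b :* ((f :* s) :* (f :* s))) S.refl σ f (Kc α) (Kc β) ⟩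
    σ ⊝ Kc α ⊛ (f ⊛ σ) ⊝ Kc β ⊛ ((f ⊛ σ) ⊛ (f ⊛ σ))
      ≈⟨ S.+-cong (S.+-congˡ {σ} (S.-‿cong (S.*-cong Kc-α f⊛σ≐X)))
                  (S.-‿cong (S.*-cong Kc-β (S.*-cong f⊛σ≐X f⊛σ≐X))) ⟩
    σ ⊝ (1s ⊕ 1s ⊝ Y) ⊛ X ⊝ (1s ⊝ Y) ⊛ (X ⊛ X)
      ≈⟨ solve 2 (λ x y → (:1 :+ x) :* ((:1 :+ x) :* :1)
                          :- (:2 :- y) :* x :- (:1 :- y) :* (x :* x)
                        := :1 :+ y :* x :+ y :* (x :* (x :* :1))) S.refl X Y ⟩
    numerator ∎
    where
    Kc-α : Kc α ≐ 1s ⊕ 1s ⊝ Y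
    Kc-α = S.trans (Kc-+ two (Poly.- y)) (S.+-cong Kc-two (Kc-⊖ y))
    Kc-β : Kc β ≐ 1s ⊝ Y
    Kc-β = S.trans (Kc-+ Poly.1# (Poly.- y)) (S.+-congˡ {Kc Poly.1#} (Kc-⊖ y))

g⊛W∘f : g ⊛ comp W ≐ 1s
g⊛W∘f = begin
  g ⊛ comp W                      ≈⟨ S.*-comm g (comp W) ⟩
  comp W ⊛ g                      ≈⟨ S.*-congˡ {comp W} (S.sym head-at-σ) ⟩
  comp W ⊛ cfStep f α β σ
    ≈⟨ S.*-congˡ {comp W} (S.+-congˡ {1s ⊝ Kc α ⊛ f} (S.-‿cong (S.*-congˡ {Kc β ⊛ pow f 2} (S.sym T∘f≐σ)))) ⟩
  comp W ⊛ cfStep f α β (comp T)  ≈⟨ comp-cfStep-inverse {W} {T} α β W-inverse ⟩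
  1s                              ∎
  where open SeriesReasoning

-- The first column μ of a right inverse M of L satisfies g · μ(f) = 1 by
-- the fundamental theorem of Riordan arrays; hence μ(f) = W(f), and μ = W.

column₀ : Mat → Series
column₀ M k = M k 0

column₀-equation : ∀ M → (∀ i j m → (Lmat ·M M) i j m ≡ IdM i j m) → g ⊛ comp (column₀ M) ≐ 1s
column₀-equation M L·M≡I i m = begin
  (g ⊛ comp μ) i m                                   ≡⟨ ≡.sym (riordan-apply g μ i m) ⟩
  Σ i (λ k → (g ⊛ pow f k) i Poly.* μ k) m          ≡⟨ ≡.sym (sumToP≡Σ i _ m) ⟩
  sumToP i (λ k → (g ⊛ pow f k) i Poly.* μ k) m     ≡⟨ sumTo-cong i entry ⟩
  (Lmat ·M M) i 0 m                                  ≡⟨ L·M≡I i 0 m ⟩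
  IdM i 0 m                                          ≡⟨ identity-column₀ i m ⟩
  1s i m                                             ∎
  where
  open ≡.≡-Reasoning
  μ = column₀ M
  entry : ∀ k → ((g ⊛ pow f k) i Poly.* μ k) m ≡ (Lmat i k *P μ k) m
  entry k = ≡.sym (≡.trans (*P≡⊛ (Lmat i k) (μ k) m) (ℤ[[y]].⊛-cong {b = μ k} (Lmat≡ i k) (λ _ → ≡.refl) m))
  identity-column₀ : ∀ i m → IdM i 0 m ≡ 1s i m
  identity-column₀ zero    zero    = ≡.refl
  identity-column₀ zero    (suc m) = ≡.refl
  identity-column₀ (suc i) m       = ≡.refl

-- μ(f) and W(f) are both inverse to g, and substitution of f is injective
column₀≐W : ∀ M → (∀ i j m → (Lmat ·M M) i j m ≡ IdM i j m) → column₀ M ≐ W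
column₀≐W M L·M≡I = comp-injective (inverse-unique {a = g} (column₀-equation M L·M≡I) g⊛W∘f)

mainTheorem4 : (M : Mat) → LowerTriangular M
               → (∀ i j m → (Lmat ·M M) i j m ≡ IdM i j m)
               → (∀ i j m → (M ·M Lmat) i j m ≡ IdM i j m)
               → ∀ n m → ∃[ N ] (∀ k → N ≤ k → convCF k n m ≡ M n 0 m)
mainTheorem4 M _ L·M≡I _ n m = suc n , λ k n<k → begin
  convCF k n m      ≡⟨ convCF≐convergent k n m ⟩
  convergent k n m  ≡⟨ convergent-≃W n<k n ≤-refl m ⟩
  W n m             ≡⟨ ≡.sym (column₀≐W M L·M≡I n m) ⟩
  M n 0 m           ∎
  where open ≡.≡-Reasoning
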